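{- Let $G$ be a minimally nonperfectly divisible graph, $X$ a clique of $G$, and $V(G)\setminus X=V_1\cup V_2$ a partition into nonempty sets with no edges between $V_1$ and $V_2$. Let $G_i=G[X\cup V_i]$ for $i=1,2$. Then neither $G_1$ nor $G_2$ is perfect.
   Context: A perfect division of a graph $H$ is a partition $(A,B)$ of $V(H)$ such that $H[A]$ is perfect and $\omega(H[B])<\omega(H)$. $G$ is perfectly divisible if every nonempty induced subgraph has a perfect division; $G$ is minimally nonperfectly divisible if $G$ is not perfectly divisible but every proper induced subgraph is. -}

module Defs where

open import Data.Nat using (ℕ; _<_; _≤_)
open import Data.Fin using (Fin)
open import Data.Bool using (Bool; true; false)
open import Data.Fin.Subset using (Subset; _∈_; _⊆_; _∪_; _∩_; ⊥; ⊤; Nonempty; ∣_∣)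
open import Data.Product using (Σ; ∃; ∃-syntax; _×_)
open import Relation.Binary.PropositionalEquality using (_≡_; _≢_)
open import Relation.Nullary using (¬_)

record Graph (n : ℕ) : Set where
  field
    adj     : Fin n → Fin n → Bool
    symm    : ∀ x y → adj x y ≡ adj y x
    irrefl  : ∀ x → adj x x ≡ false

open Graph public

-- Induced subgraphs of G are represented by vertex subsets S : Subset n.

IsClique : ∀ {n} → Graph n → Subset n → Set
IsClique G K = ∀ x y → x ∈ K → y ∈ K → x ≢ y → adj G x y ≡ true

IsCliqueNumber : ∀ {n} → Graph n → Subset n → ℕ → Set
IsCliqueNumber G S k =
  (∃[ K ] (K ⊆ S × IsClique G K × ∣ K ∣ ≡ k)) ×
  (∀ K → K ⊆ S → IsClique G K → ∣ K ∣ ≤ k)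

ω<ω : ∀ {n} → Graph n → Subset n → Subset n → Set
ω<ω G B S = ∀ kB kS → IsCliqueNumber G B kB → IsCliqueNumber G S kS → kB < kS

Colourable : ∀ {n} → Graph n → Subset n → ℕ → Set
Colourable {n} G S k =
  Σ ((v : Fin n) → v ∈ S → Fin k) λ c →
    ∀ x y (px : x ∈ S) (py : y ∈ S) → adj G x y ≡ true → c x px ≢ c y py

-- G[S] is perfect: every induced subgraph H has χ(H) = ω(H)
-- (χ(H) ≥ ω(H) always holds, so it suffices that H is ω(H)-colourable).
Perfect : ∀ {n} → Graph n → Subset n → Set
Perfect G S = ∀ T → T ⊆ S → ∀ k → IsCliqueNumber G T k → Colourable G T k

PerfectDivision : ∀ {n} → Graph n → Subset n → Subset n → Subset n → Set
PerfectDivision G S A B =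
  (A ∪ B ≡ S) × (A ∩ B ≡ ⊥) × Perfect G A × ω<ω G B S

PerfectlyDivisible : ∀ {n} → Graph n → Subset n → Set
PerfectlyDivisible G S =
  ∀ T → T ⊆ S → Nonempty T → ∃[ A ] ∃[ B ] PerfectDivision G T A B

MinimallyNonPD : ∀ {n} → Graph n → Set
MinimallyNonPD G =
  ¬ PerfectlyDivisible G ⊤ × (∀ S → S ⊆ ⊤ → S ≢ ⊤ → PerfectlyDivisible G S)

{-# OPTIONS --safe #-}

-- Suppose G[X ∪ V₁] is perfect. The proper induced subgraph G[X ∪ V₂] has a perfect
-- division (A, B), and (A ∪ V₁, B) is then a perfect division of G: ω(B) < ω(X ∪ V₂) ≤ ω(G),
-- and G[A ∪ V₁] is perfect because it is glued from the perfect graphs G[A] and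
-- G[(X ∩ A) ∪ V₁] along the clique X ∩ A, with no edges between the two sides off the
-- clique. Gluing along a clique preserves perfection, since colourings of the two sides can
-- be permuted to agree on the clique. As every proper induced subgraph of G has a perfect
-- division as well, G would be perfectly divisible.

module Submission where

open import Defs
open import Data.Bool using (true; false)
import Data.Bool.Properties as Bool
open import Data.Fin using (Fin; inject≤; _≟_)
open import Data.Fin.Permutation.Components using (transpose; transpose-inverse)
open import Data.Fin.Properties using (all?; inject≤-injective)
open import Data.Fin.Subset using (Subset; _∈_; _∉_; _⊆_; _∪_; _∩_; ⊥; ⊤; Nonempty; ∣_∣)
open import Data.Fin.Subset.Properties
  using ( _∈?_; _⊆?_; anySubset?; ∉⊥; ∈⊤; ⊆⊤; ⊆-min; ⊆-refl; ∣p∣≤n; ∣⊥∣≡0; Empty-unique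
        ; x∈p∪q⁺; x∈p∪q⁻; x∈p∩q⁺; x∈p∩q⁻; p∩q⊆p; p∩q⊆q; p⊆p∪q
        ; ∪-assoc; ∪-comm; ∪-identityˡ; ∩-comm; ∩-distribˡ-∪; ∩-distribʳ-∪ )
open import Data.List using (List; []; _∷_; allFin)
open import Data.List.Membership.Propositional using () renaming (_∈_ to _∈ₗ_)
open import Data.List.Membership.Propositional.Properties using (∈-allFin)
open import Data.List.Relation.Unary.Any using (here; there)
open import Data.Nat using (ℕ; zero; suc; _≤_)
import Data.Nat.Properties as ℕ
open import Data.Product using (Σ; ∃; _×_; _,_; proj₁)
open import Data.Sum using (_⊎_; inj₁; inj₂)
open import Data.Vec.Properties using (≡-dec)
open import Data.Vec.Properties.WithK using ([]=-irrelevant)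
open import Relation.Binary.PropositionalEquality
  using (_≡_; _≢_; refl; sym; trans; cong; cong₂; subst; module ≡-Reasoning)
open import Relation.Nullary using (¬_; Dec; yes; no; contradiction)
open import Relation.Nullary.Decidable using (_→-dec_; _×-dec_; ¬?)

open ≡-Reasoning

private variable
  n : ℕ
  x : Fin n
  P Q R : Subset n

transpose-matchˡ : ∀ {k} (a b : Fin k) → transpose a b a ≡ b
transpose-matchˡ a b with a ≟ a
... | yes _   = refl
... | no a≢a = contradiction refl a≢a

transpose-fixed : ∀ {k} {a b c : Fin k} → c ≢ a → c ≢ b → transpose a b c ≡ c
transpose-fixed {a = a} {b} {c} c≢a c≢b with c ≟ a
... | yes c≡a = contradiction c≡a c≢a
... | no _ with c ≟ b
...   | yes c≡b = contradiction c≡b c≢b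
...   | no _    = refl

transpose-injective : ∀ {k} (a b : Fin k) {c d} → transpose a b c ≡ transpose a b d → c ≡ d
transpose-injective a b {c} {d} eq = begin
  c                               ≡⟨ transpose-inverse b a ⟨
  transpose b a (transpose a b c) ≡⟨ cong (transpose b a) eq ⟩
  transpose b a (transpose a b d) ≡⟨ transpose-inverse b a ⟩
  d                               ∎

x∈p∪q∧x∉q⇒x∈p : x ∈ P ∪ Q → x ∉ Q → x ∈ P
x∈p∪q∧x∉q⇒x∈p {P = P} {Q} x∈P∪Q x∉Q with x∈p∪q⁻ P Q x∈P∪Q
... | inj₁ x∈P = x∈P
... | inj₂ x∈Q = contradiction x∈Q x∉Q

∩≡⊥⇒x∉q : P ∩ Q ≡ ⊥ → x ∈ P → x ∉ Q
∩≡⊥⇒x∉q P∩Q≡⊥ x∈P x∈Q = ∉⊥ (subst (_ ∈_) P∩Q≡⊥ (x∈p∩q⁺ (x∈P , x∈Q)))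

∩≡⊥-⊆ʳ : Q ⊆ R → P ∩ R ≡ ⊥ → P ∩ Q ≡ ⊥
∩≡⊥-⊆ʳ {Q = Q} {P = P} Q⊆R P∩R≡⊥ = Empty-unique λ (_ , x∈P∩Q) →
  let x∈P , x∈Q = x∈p∩q⁻ P Q x∈P∩Q in ∩≡⊥⇒x∉q P∩R≡⊥ x∈P (Q⊆R x∈Q)

∪≡⇒⊆ˡ : P ∪ Q ≡ R → P ⊆ R
∪≡⇒⊆ˡ P∪Q≡R x∈P = subst (_ ∈_) P∪Q≡R (x∈p∪q⁺ (inj₁ x∈P))

∪≡⇒⊆ʳ : P ∪ Q ≡ R → Q ⊆ R
∪≡⇒⊆ʳ P∪Q≡R x∈Q = subst (_ ∈_) P∪Q≡R (x∈p∪q⁺ (inj₂ x∈Q))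

module _ {n : ℕ} (G : Graph n) where

  private variable
    S S₁ S₂ T C K X V V₁ V₂ A B : Subset n
    k l : ℕ

  NoEdgesBetween : Subset n → Subset n → Set
  NoEdgesBetween P Q = ∀ x y → x ∈ P → y ∈ Q → adj G x y ≡ false

  NoEdgesBetween-sym : NoEdgesBetween P Q → NoEdgesBetween Q P
  NoEdgesBetween-sym noEdges x y x∈Q y∈P = trans (symm G x y) (noEdges y x y∈P x∈Q)

  IntersectionSeparates : Subset n → Subset n → Set
  IntersectionSeparates S₁ S₂ =
    ∀ x y → x ∈ S₁ → y ∈ S₂ → adj G x y ≡ true → x ∈ S₂ ⊎ y ∈ S₁

  isClique? : ∀ K → Dec (IsClique G K)
  isClique? K = all? λ x → all? λ y →
    x ∈? K →-dec y ∈? K →-dec ¬? (x ≟ y) →-dec adj G x y Bool.≟ true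

  ⊥-isClique : IsClique G ⊥
  ⊥-isClique _ _ x∈⊥ = contradiction x∈⊥ ∉⊥

  isClique-⊆ : K ⊆ C → IsClique G C → IsClique G K
  isClique-⊆ K⊆C C-clique x y x∈K y∈K = C-clique x y (K⊆C x∈K) (K⊆C y∈K)

  CliqueBound : Subset n → ℕ → Set
  CliqueBound S k = ∀ K → K ⊆ S → IsClique G K → ∣ K ∣ ≤ k

  CliqueBound-⊆ : T ⊆ S → CliqueBound S k → CliqueBound T k
  CliqueBound-⊆ T⊆S bound K K⊆T = bound K (λ x∈K → T⊆S (K⊆T x∈K))

  cliqueNumber≤bound : IsCliqueNumber G S k → CliqueBound S l → k ≤ l
  cliqueNumber≤bound ((K , K⊆S , K-clique , refl) , _) bound = bound K K⊆S K-clique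

  cliqueNumber-mono : T ⊆ S → IsCliqueNumber G T k → IsCliqueNumber G S l → k ≤ l
  cliqueNumber-mono T⊆S ωT (_ , boundS) = cliqueNumber≤bound ωT (CliqueBound-⊆ T⊆S boundS)

  cliqueNumber≤ : ∀ S j → CliqueBound S j → ∃ (IsCliqueNumber G S)
  cliqueNumber≤ S zero    bound = zero , (⊥ , ⊆-min S , ⊥-isClique , ∣⊥∣≡0 n) , bound
  cliqueNumber≤ S (suc j) bound
    with anySubset? (λ K → K ⊆? S ×-dec isClique? K ×-dec ∣ K ∣ ℕ.≟ suc j)
  ... | yes clique = suc j , clique , bound
  ... | no ∄clique = cliqueNumber≤ S j λ K K⊆S K-clique →
    ℕ.m<1+n⇒m≤n (ℕ.≤∧≢⇒< (bound K K⊆S K-clique)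
      λ ∣K∣≡1+j → ∄clique (K , K⊆S , K-clique , ∣K∣≡1+j))

  cliqueNumber : ∀ S → ∃ (IsCliqueNumber G S)
  cliqueNumber S = cliqueNumber≤ S n λ K _ _ → ∣p∣≤n K

  Colourable-⊆ : T ⊆ S → Colourable G S k → Colourable G T k
  Colourable-⊆ T⊆S (c , proper) =
    (λ v v∈T → c v (T⊆S v∈T)) , λ x y x∈T y∈T → proper x y (T⊆S x∈T) (T⊆S y∈T)

  Colourable-≤ : k ≤ l → Colourable G S k → Colourable G S l
  Colourable-≤ k≤l (c , proper) =
    (λ v v∈S → inject≤ (c v v∈S) k≤l) ,
    λ x y x∈S y∈S xy cx≡cy → proper x y x∈S y∈S xy (inject≤-injective k≤l k≤l _ _ cx≡cy)

  Colourable-transpose : Fin k → Fin k → Colourable G S k → Colourable G S k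
  Colourable-transpose a b (c , proper) =
    (λ v v∈S → transpose a b (c v v∈S)) ,
    λ x y x∈S y∈S xy eq → proper x y x∈S y∈S xy (transpose-injective a b eq)

  Perfect-⊆ : T ⊆ S → Perfect G S → Perfect G T
  Perfect-⊆ T⊆S perfect U U⊆T = perfect U (λ x∈U → T⊆S (U⊆T x∈U))

  Perfect⇒Colourable : Perfect G S → CliqueBound S k → Colourable G S k
  Perfect⇒Colourable {S} perfect bound =
    let ω , isω = cliqueNumber S in
    Colourable-≤ (cliqueNumber≤bound isω bound) (perfect S ⊆-refl ω isω)

  -- Vertex by vertex, swap the current and the prescribed colour of the next vertex of C;
  -- the vertices of C already matched are adjacent to it, so neither colour is theirs.
  matchOnClique : IsClique G C → C ⊆ S → Colourable G S k → (f : Colourable G C k) →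
    Σ (Colourable G S k) λ d → ∀ v (v∈C : v ∈ C) (v∈S : v ∈ S) → proj₁ d v v∈S ≡ proj₁ f v v∈C
  matchOnClique {C} {S} {k} C-clique C⊆S c (f , f-proper) =
    let d , agrees = matchOn (allFin n) in d , λ v → agrees v (∈-allFin v)
    where
    AgreesOn : List (Fin n) → Colourable G S k → Set
    AgreesOn vs (d , _) = ∀ v → v ∈ₗ vs → (v∈C : v ∈ C) (v∈S : v ∈ S) → d v v∈S ≡ f v v∈C

    matchOn : ∀ vs → Σ (Colourable G S k) (AgreesOn vs)
    matchOn [] = c , λ _ ()
    matchOn (y ∷ vs) with matchOn vs | y ∈? C
    ... | d , agrees | no y∉C = d , λ where
      _ (here refl)  y∈C → contradiction y∈C y∉C
      v (there v∈vs)     → agrees v v∈vs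
    ... | (d , d-proper) , agrees | yes y∈C = Colourable-transpose a b (d , d-proper) , agrees′
      where
      a b : Fin k
      a = d y (C⊆S y∈C)
      b = f y y∈C

      agrees-y : (p : y ∈ C) (q : y ∈ S) → transpose a b (d y q) ≡ f y p
      agrees-y p q rewrite []=-irrelevant p y∈C | []=-irrelevant q (C⊆S y∈C) =
        transpose-matchˡ a b

      agrees′ : AgreesOn (y ∷ vs) (Colourable-transpose a b (d , d-proper))
      agrees′ _ (here refl) = agrees-y
      agrees′ v (there v∈vs) v∈C v∈S with v ≟ y
      ... | yes refl = agrees-y v∈C v∈S
      ... | no v≢y = begin
        transpose a b (d v v∈S) ≡⟨ cong (transpose a b) dv≡fv ⟩
        transpose a b (f v v∈C) ≡⟨ transpose-fixed fv≢a fv≢b ⟩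
        f v v∈C                 ∎
        where
        dv≡fv : d v v∈S ≡ f v v∈C
        dv≡fv = agrees v v∈vs v∈C v∈S
        vy : adj G v y ≡ true
        vy = C-clique v y v∈C y∈C v≢y
        fv≢a : f v v∈C ≢ a
        fv≢a fv≡a = d-proper v y v∈S (C⊆S y∈C) vy (trans dv≡fv fv≡a)
        fv≢b : f v v∈C ≢ b
        fv≢b = f-proper v y v∈C y∈C vy

  Colourable-glue : IsClique G (S₁ ∩ S₂) → IntersectionSeparates S₁ S₂ →
    Colourable G S₁ k → Colourable G S₂ k → Colourable G (S₁ ∪ S₂) k
  Colourable-glue {S₁} {S₂} {k} clique separates c₁ (c₂ , proper₂)
    with matchOnClique clique (p∩q⊆p S₁ S₂) c₁ (Colourable-⊆ (p∩q⊆q S₁ S₂) (c₂ , proper₂))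
  ... | (d , proper₁) , agrees = colour , proper
    where
    agrees′ : ∀ {x} (x∈S₁ : x ∈ S₁) (x∈S₂ : x ∈ S₂) → d x x∈S₁ ≡ c₂ x x∈S₂
    agrees′ {x} x∈S₁ x∈S₂ = begin
      d x x∈S₁                   ≡⟨ agrees x x∈S₁∩S₂ x∈S₁ ⟩
      c₂ x (p∩q⊆q S₁ S₂ x∈S₁∩S₂) ≡⟨ cong (c₂ x) ([]=-irrelevant _ x∈S₂) ⟩
      c₂ x x∈S₂                  ∎
      where x∈S₁∩S₂ = x∈p∩q⁺ (x∈S₁ , x∈S₂)

    colourBy : ∀ {v} → v ∈ S₁ ∪ S₂ → Dec (v ∈ S₂) → Fin k
    colourBy _   (yes v∈S₂) = c₂ _ v∈S₂
    colourBy v∈S (no v∉S₂)  = d _ (x∈p∪q∧x∉q⇒x∈p v∈S v∉S₂)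

    colour : (v : Fin n) → v ∈ S₁ ∪ S₂ → Fin k
    colour v v∈S = colourBy v∈S (v ∈? S₂)

    crossing : ∀ {x y} (x∈S₂ : x ∈ S₂) (y∈S₁ : y ∈ S₁) → y ∉ S₂ →
      adj G x y ≡ true → c₂ x x∈S₂ ≢ d y y∈S₁
    crossing {x} {y} x∈S₂ y∈S₁ y∉S₂ xy with separates y x y∈S₁ x∈S₂ (trans (symm G y x) xy)
    ... | inj₁ y∈S₂ = contradiction y∈S₂ y∉S₂
    ... | inj₂ x∈S₁ = λ c₂x≡dy → proper₁ x y x∈S₁ y∈S₁ xy (trans (agrees′ x∈S₁ x∈S₂) c₂x≡dy)

    properBy : ∀ {x y} (x∈S : x ∈ S₁ ∪ S₂) (y∈S : y ∈ S₁ ∪ S₂) x∈S₂? y∈S₂? →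
      adj G x y ≡ true → colourBy x∈S x∈S₂? ≢ colourBy y∈S y∈S₂?
    properBy _ _ (yes x∈S₂) (yes y∈S₂) = proper₂ _ _ x∈S₂ y∈S₂
    properBy _ _ (no _)     (no _)     = proper₁ _ _ _ _
    properBy _ y∈S (yes x∈S₂) (no y∉S₂) = crossing x∈S₂ _ y∉S₂
    properBy {x} {y} x∈S _ (no x∉S₂) (yes y∈S₂) xy eq =
      crossing y∈S₂ _ x∉S₂ (trans (symm G y x) xy) (sym eq)

    proper : ∀ x y (x∈S : x ∈ S₁ ∪ S₂) (y∈S : y ∈ S₁ ∪ S₂) →
      adj G x y ≡ true → colour x x∈S ≢ colour y y∈S
    proper x y x∈S y∈S = properBy x∈S y∈S (x ∈? S₂) (y ∈? S₂)

  Perfect-glue : IsClique G (S₁ ∩ S₂) → IntersectionSeparates S₁ S₂ →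
    Perfect G S₁ → Perfect G S₂ → Perfect G (S₁ ∪ S₂)
  Perfect-glue {S₁} {S₂} clique separates perfect₁ perfect₂ T T⊆S k (_ , bound) =
    Colourable-⊆ T⊆pieces
      (Colourable-glue cliqueT separatesT (colourPiece perfect₁) (colourPiece perfect₂))
    where
    colourPiece : ∀ {P} → Perfect G P → Colourable G (T ∩ P) k
    colourPiece perfect =
      Perfect⇒Colourable (Perfect-⊆ (p∩q⊆q T _) perfect) (CliqueBound-⊆ (p∩q⊆p T _) bound)

    cliqueT : IsClique G ((T ∩ S₁) ∩ (T ∩ S₂))
    cliqueT = isClique-⊆ inS₁∩S₂ clique
      where
      inS₁∩S₂ : (T ∩ S₁) ∩ (T ∩ S₂) ⊆ S₁ ∩ S₂
      inS₁∩S₂ x∈ = let x∈T∩S₁ , x∈T∩S₂ = x∈p∩q⁻ (T ∩ S₁) (T ∩ S₂) x∈ in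
        x∈p∩q⁺ (p∩q⊆q T S₁ x∈T∩S₁ , p∩q⊆q T S₂ x∈T∩S₂)

    separatesT : IntersectionSeparates (T ∩ S₁) (T ∩ S₂)
    separatesT x y x∈ y∈ xy with separates x y (p∩q⊆q T S₁ x∈) (p∩q⊆q T S₂ y∈) xy
    ... | inj₁ x∈S₂ = inj₁ (x∈p∩q⁺ (p∩q⊆p T S₁ x∈ , x∈S₂))
    ... | inj₂ y∈S₁ = inj₂ (x∈p∩q⁺ (p∩q⊆p T S₂ y∈ , y∈S₁))

    T⊆pieces : T ⊆ T ∩ S₁ ∪ T ∩ S₂
    T⊆pieces x∈T = subst (_ ∈_) (∩-distribˡ-∪ T S₁ S₂) (x∈p∩q⁺ (x∈T , T⊆S x∈T))

  perfectDivision-extend : IsClique G X → V ∩ S ≡ ⊥ →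
    (∀ v s → v ∈ V → s ∈ S → adj G v s ≡ true → s ∈ X) →
    Perfect G (X ∪ V) → PerfectDivision G S A B → PerfectDivision G (S ∪ V) (A ∪ V) B
  perfectDivision-extend {X} {V} {S} {A} {B} X-clique V∩S≡⊥ separated perfectX∪V
    (A∪B≡S , A∩B≡⊥ , perfectA , ωB<ωS) = cover , disjoint , perfect , ωB<ωS∪V
    where
    cover : (A ∪ V) ∪ B ≡ S ∪ V
    cover = begin
      (A ∪ V) ∪ B ≡⟨ ∪-assoc A V B ⟩
      A ∪ V ∪ B   ≡⟨ cong (A ∪_) (∪-comm V B) ⟩
      A ∪ B ∪ V   ≡⟨ ∪-assoc A B V ⟨
      (A ∪ B) ∪ V ≡⟨ cong (_∪ V) A∪B≡S ⟩
      S ∪ V       ∎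

    disjoint : (A ∪ V) ∩ B ≡ ⊥
    disjoint = begin
      (A ∪ V) ∩ B   ≡⟨ ∩-distribʳ-∪ B A V ⟩
      A ∩ B ∪ V ∩ B ≡⟨ cong₂ _∪_ A∩B≡⊥ (∩≡⊥-⊆ʳ (∪≡⇒⊆ʳ A∪B≡S) V∩S≡⊥) ⟩
      ⊥ ∪ ⊥         ≡⟨ ∪-identityˡ ⊥ ⟩
      ⊥             ∎

    -- Only X ∩ A may be glued to A: vertices of X ∩ B can have neighbours in A outside X.
    perfectX∩A∪V : Perfect G (X ∩ A ∪ V)
    perfectX∩A∪V = Perfect-⊆ inX∪V perfectX∪V
      where
      inX∪V : X ∩ A ∪ V ⊆ X ∪ V
      inX∪V x∈ with x∈p∪q⁻ (X ∩ A) V x∈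
      ... | inj₁ x∈X∩A = x∈p∪q⁺ (inj₁ (p∩q⊆p X A x∈X∩A))
      ... | inj₂ x∈V   = x∈p∪q⁺ (inj₂ x∈V)

    clique : IsClique G (A ∩ (X ∩ A ∪ V))
    clique = isClique-⊆ inX X-clique
      where
      inX : A ∩ (X ∩ A ∪ V) ⊆ X
      inX x∈ with x∈p∩q⁻ A (X ∩ A ∪ V) x∈
      ... | x∈A , x∈X∩A∪V with x∈p∪q⁻ (X ∩ A) V x∈X∩A∪V
      ...   | inj₁ x∈X∩A = p∩q⊆p X A x∈X∩A
      ...   | inj₂ x∈V   = contradiction (∪≡⇒⊆ˡ A∪B≡S x∈A) (∩≡⊥⇒x∉q V∩S≡⊥ x∈V)

    separates : IntersectionSeparates A (X ∩ A ∪ V)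
    separates a y a∈A y∈ ay with x∈p∪q⁻ (X ∩ A) V y∈
    ... | inj₁ y∈X∩A = inj₂ (p∩q⊆q X A y∈X∩A)
    ... | inj₂ y∈V   = inj₁ (x∈p∪q⁺ (inj₁ (x∈p∩q⁺ (a∈X , a∈A))))
      where
      a∈X : a ∈ X
      a∈X = separated y a y∈V (∪≡⇒⊆ˡ A∪B≡S a∈A) (trans (symm G y a) ay)

    perfect : Perfect G (A ∪ V)
    perfect = Perfect-⊆ inA∪pieces (Perfect-glue clique separates perfectA perfectX∩A∪V)
      where
      inA∪pieces : A ∪ V ⊆ A ∪ X ∩ A ∪ V
      inA∪pieces x∈ with x∈p∪q⁻ A V x∈
      ... | inj₁ x∈A = x∈p∪q⁺ (inj₁ x∈A)
      ... | inj₂ x∈V = x∈p∪q⁺ (inj₂ (x∈p∪q⁺ (inj₂ x∈V)))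

    ωB<ωS∪V : ω<ω G B (S ∪ V)
    ωB<ωS∪V kB k ωB ωS∪V =
      let kS , ωS = cliqueNumber S in
      ℕ.<-≤-trans (ωB<ωS kB kS ωB ωS) (cliqueNumber-mono (p⊆p∪q V) ωS ωS∪V)

  minimallyNonPD⇒indivisible : MinimallyNonPD G → ¬ PerfectDivision G ⊤ A B
  minimallyNonPD⇒indivisible {A} {B} (notDivisible , minimal) division = notDivisible divisible
    where
    divisible : PerfectlyDivisible G ⊤
    divisible T _ T≢∅ with ≡-dec Bool._≟_ T ⊤
    ... | yes refl = A , B , division
    ... | no T≢⊤   = minimal T ⊆⊤ T≢⊤ T ⊆-refl T≢∅

  cliqueSide-¬Perfect : MinimallyNonPD G → IsClique G X → X ∪ V₁ ∪ V₂ ≡ ⊤ →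
    X ∩ V₁ ≡ ⊥ → V₁ ∩ V₂ ≡ ⊥ → Nonempty V₁ → Nonempty V₂ → NoEdgesBetween V₁ V₂ →
    ¬ Perfect G (X ∪ V₁)
  cliqueSide-¬Perfect {X} {V₁} {V₂} mnpd@(_ , minimal) X-clique whole X∩V₁≡⊥ V₁∩V₂≡⊥
    (u , u∈V₁) (w , w∈V₂) noEdges perfectX∪V₁ =
    let A , B , division = minimal (X ∪ V₂) ⊆⊤ X∪V₂≢⊤ (X ∪ V₂) ⊆-refl (w , x∈p∪q⁺ (inj₂ w∈V₂))
    in minimallyNonPD⇒indivisible mnpd
         (subst (λ S → PerfectDivision G S (A ∪ V₁) B) whole′
           (perfectDivision-extend X-clique V₁∩X∪V₂≡⊥ separated perfectX∪V₁ division))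
    where
    whole′ : (X ∪ V₂) ∪ V₁ ≡ ⊤
    whole′ = begin
      (X ∪ V₂) ∪ V₁ ≡⟨ ∪-assoc X V₂ V₁ ⟩
      X ∪ V₂ ∪ V₁   ≡⟨ cong (X ∪_) (∪-comm V₂ V₁) ⟩
      X ∪ V₁ ∪ V₂   ≡⟨ whole ⟩
      ⊤             ∎

    V₁∩X∪V₂≡⊥ : V₁ ∩ (X ∪ V₂) ≡ ⊥
    V₁∩X∪V₂≡⊥ = begin
      V₁ ∩ (X ∪ V₂)     ≡⟨ ∩-distribˡ-∪ V₁ X V₂ ⟩
      V₁ ∩ X ∪ V₁ ∩ V₂  ≡⟨ cong₂ _∪_ (trans (∩-comm V₁ X) X∩V₁≡⊥) V₁∩V₂≡⊥ ⟩
      ⊥ ∪ ⊥             ≡⟨ ∪-identityˡ ⊥ ⟩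
      ⊥                 ∎

    X∪V₂≢⊤ : X ∪ V₂ ≢ ⊤
    X∪V₂≢⊤ X∪V₂≡⊤ = ∩≡⊥⇒x∉q V₁∩X∪V₂≡⊥ u∈V₁ (subst (u ∈_) (sym X∪V₂≡⊤) ∈⊤)

    separated : ∀ v s → v ∈ V₁ → s ∈ X ∪ V₂ → adj G v s ≡ true → s ∈ X
    separated v s v∈V₁ s∈X∪V₂ vs with x∈p∪q⁻ X V₂ s∈X∪V₂
    ... | inj₁ s∈X  = s∈X
    ... | inj₂ s∈V₂ = contradiction (trans (sym vs) (noEdges v s v∈V₁ s∈V₂)) λ ()

lemma5 : ∀ {n} (G : Graph n) → MinimallyNonPD G →
    ∀ (X V₁ V₂ : Subset n) → IsClique G X →
    X ∪ V₁ ∪ V₂ ≡ ⊤ → X ∩ V₁ ≡ ⊥ → X ∩ V₂ ≡ ⊥ → V₁ ∩ V₂ ≡ ⊥ →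
    Nonempty V₁ → Nonempty V₂ →
    (∀ x y → x ∈ V₁ → y ∈ V₂ → adj G x y ≡ false) →
    ¬ Perfect G (X ∪ V₁) × ¬ Perfect G (X ∪ V₂)
lemma5 G mnpd X V₁ V₂ X-clique whole X∩V₁≡⊥ X∩V₂≡⊥ V₁∩V₂≡⊥ V₁≢∅ V₂≢∅ noEdges =
  cliqueSide-¬Perfect G mnpd X-clique whole X∩V₁≡⊥ V₁∩V₂≡⊥ V₁≢∅ V₂≢∅ noEdges ,
  cliqueSide-¬Perfect G mnpd X-clique (trans (cong (X ∪_) (∪-comm V₂ V₁)) whole)
    X∩V₂≡⊥ (trans (∩-comm V₂ V₁) V₁∩V₂≡⊥) V₂≢∅ V₁≢∅ (NoEdgesBetween-sym G noEdges)
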